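{- Let $G$ and $H$ be interval colorable graphs, where $H$ is $r$-regular with $|V(H)|=n$. Then $G[H]$ is interval colorable, and $$w(G[H])\le w(G)\cdot n+r\quad\text{and}\quad W(G[H])\ge W(G)\cdot n+r.$$
   Context: All graphs are finite, undirected, without loops or multiple edges. A proper edge-coloring with consecutive integers $c_1,\ldots,c_t$ is an interval $t$-coloring if all $t$ colors are used and the set of colors on edges incident to each vertex is an interval of integers. A graph is interval colorable if it has an interval $t$-coloring for some positive integer $t$; $w(G)$ and $W(G)$ denote the smallest and largest such $t$. The composition $G[H]$ has vertex set $V(G)\times V(H)$, with $(u_1,v_1)(u_2,v_2)$ an edge iff $u_1u_2\in E(G)$, or $u_1=u_2$ and $v_1v_2\in E(H)$. -}

module Defs where

open import Data.Nat using (ℕ; zero; suc; _+_; _*_; _≤_)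
open import Data.Bool using (Bool; true; false; _∨_; _∧_; if_then_else_)
open import Data.Fin using (Fin; remQuot; _≟_)
open import Data.List using (List; map; allFin)
open import Data.Nat.ListAction using (sum)
open import Data.Product using (Σ; ∃; ∃-syntax; _×_; _,_; proj₁; proj₂)
open import Relation.Nullary.Decidable using (⌊_⌋)
open import Relation.Binary.PropositionalEquality using (_≡_; refl; cong₂; sym)
open import Relation.Nullary using (yes; no)

record Graph : Set where
  field
    n     : ℕ
    adj   : Fin n → Fin n → Bool
    symm  : ∀ u v → adj u v ≡ adj v u
    irrefl : ∀ v → adj v v ≡ false
open Graph public

degree : (G : Graph) → Fin (n G) → ℕ
degree G v = sum (map (λ u → if adj G v u then 1 else 0) (allFin (n G)))

Regular : Graph → ℕ → Set
Regular G r = ∀ v → degree G v ≡ r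

-- An edge-colouring assigns to each ordered pair a natural number; only its
-- values on edges matter.
Colouring : Graph → Set
Colouring G = Fin (n G) → Fin (n G) → ℕ

ColourAt : (G : Graph) → Colouring G → Fin (n G) → ℕ → Set
ColourAt G c v k = ∃[ u ] (adj G v u ≡ true × c v u ≡ k)

record IsIntervalColouring (G : Graph) (t : ℕ) (c : Colouring G) : Set where
  field
    positive  : 1 ≤ t
    symmetric : ∀ u v → adj G u v ≡ true → c u v ≡ c v u
    inRange   : ∀ u v → adj G u v ≡ true → 1 ≤ c u v × c u v ≤ t
    proper    : ∀ v u w → adj G v u ≡ true → adj G v w ≡ true →
                c v u ≡ c v w → u ≡ w
    allUsed   : ∀ k → 1 ≤ k → k ≤ t → ∃[ u ] ∃[ v ] (adj G u v ≡ true × c u v ≡ k)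
    interval  : ∀ v a b k → ColourAt G c v a → ColourAt G c v b →
                a ≤ k → k ≤ b → ColourAt G c v k

HasIntervalColouring : Graph → ℕ → Set
HasIntervalColouring G t = Σ (Colouring G) (IsIntervalColouring G t)

IntervalColourable : Graph → Set
IntervalColourable G = ∃[ t ] HasIntervalColouring G t

IsW-min : Graph → ℕ → Set
IsW-min G m = HasIntervalColouring G m × (∀ t → HasIntervalColouring G t → m ≤ t)

IsW-max : Graph → ℕ → Set
IsW-max G m = HasIntervalColouring G m × (∀ t → HasIntervalColouring G t → t ≤ m)

-- composition (lexicographic product) G[H]; vertex (u,v) is encoded as
-- Fin.combine u v : Fin (n G * n H), decoded by remQuot.
composeAdj : (G H : Graph) → Fin (n G * n H) → Fin (n G * n H) → Bool
composeAdj G H x y =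
  adj G u₁ u₂ ∨ (⌊ u₁ ≟ u₂ ⌋ ∧ adj H v₁ v₂)
  where
  u₁ = proj₁ (remQuot {n G} (n H) x)
  v₁ = proj₂ (remQuot {n G} (n H) x)
  u₂ = proj₁ (remQuot {n G} (n H) y)
  v₂ = proj₂ (remQuot {n G} (n H) y)

private
  ≟-sym : ∀ {m} (a b : Fin m) → ⌊ a ≟ b ⌋ ≡ ⌊ b ≟ a ⌋
  ≟-sym a b with a ≟ b | b ≟ a
  ... | yes _ | yes _ = refl
  ... | no _  | no _  = refl
  ... | yes p | no q  with q (sym p)
  ... | ()
  ≟-sym a b | no p | yes q with p (sym q)
  ... | ()

  ≟-refl : ∀ {m} (a : Fin m) → ⌊ a ≟ a ⌋ ≡ true
  ≟-refl a with a ≟ a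
  ... | yes _ = refl
  ... | no p with p refl
  ... | ()

  composeSym : (G H : Graph) → ∀ x y → composeAdj G H x y ≡ composeAdj G H y x
  composeSym G H x y =
    cong₂ _∨_ (symm G u₁ u₂) (cong₂ _∧_ (≟-sym u₁ u₂) (symm H v₁ v₂))
    where
    u₁ = proj₁ (remQuot {n G} (n H) x)
    v₁ = proj₂ (remQuot {n G} (n H) x)
    u₂ = proj₁ (remQuot {n G} (n H) y)
    v₂ = proj₂ (remQuot {n G} (n H) y)

  composeIrr : (G H : Graph) → ∀ x → composeAdj G H x x ≡ false
  composeIrr G H x
    rewrite irrefl G (proj₁ (remQuot {n G} (n H) x))
          | ≟-refl (proj₁ (remQuot {n G} (n H) x))
          | irrefl H (proj₂ (remQuot {n G} (n H) x)) = refl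

_[_] : Graph → Graph → Graph
G [ H ] = record
  { n = n G * n H
  ; adj = composeAdj G H
  ; symm = composeSym G H
  ; irrefl = composeIrr G H
  }

module Submission where

-- Let α be an interval t-colouring of G and β an interval colouring of the
-- r-regular graph H on N vertices.  Reducing β modulo r gives a proper colouring
-- of H with r colours in which every vertex sees every residue, because r + 1
-- colours cannot occur at a vertex of degree r.  In G [ H ] the edges from (u,v)
-- into the copy of a G-neighbour u′ receive the α(uu′)-th block of N colours, via
-- the Latin square (v,v′) ↦ (v + v′) mod N; the H-edges at (u,v) receive the r
-- colours directly above the highest block used at u, one for each residue.
-- This is an interval (t·N + r)-colouring of G [ H ].  Applied to colourings of G
-- with w(G) and with W(G) colours it yields the two bounds.

open import Defs
open import Data.Nat using (ℕ; zero; suc; pred; _+_; _*_; _∸_; _≤_; _<_; z≤n; s≤s; s≤s⁻¹; NonZero; >-nonZero; >-nonZero⁻¹; _⊔_)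
open import Data.Nat.Properties
open import Data.Nat.DivMod
open import Data.Nat.ListAction using (sum)
open import Data.Bool using (Bool; true; false; if_then_else_; _∨_; _∧_)
open import Data.Bool.Properties using (∨-zeroʳ)
import Data.Bool as Bool
open import Data.Fin as Fin using (Fin; toℕ; fromℕ<; punchOut; remQuot; combine)
import Data.Fin.Properties as FinP
open import Data.List using (List; []; _∷_; map; allFin; filter; length; lookup)
open import Data.List.Membership.Propositional using (_∈_)
open import Data.List.Membership.Propositional.Properties
  using (∈-allFin; ∈-filter⁺; ∈-filter⁻; ∈-lookup; ∈-length)
open import Data.List.Relation.Unary.Any as Any using (here; there)
open import Data.List.Relation.Unary.Any.Properties using (lookup-index)
import Data.List.Relation.Unary.All as All
open import Data.List.Relation.Unary.AllPairs using (_∷_)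
open import Data.List.Relation.Unary.Unique.Propositional using (Unique)
open import Data.List.Relation.Unary.Unique.Propositional.Properties using (allFin⁺; filter⁺)
open import Data.Product using (∃-syntax; _×_; _,_; proj₁; proj₂)
open import Data.Sum using (_⊎_; inj₁; inj₂)
open import Data.Empty using (⊥; ⊥-elim)
open import Function.Definitions using (Injective)
open import Relation.Nullary using (Dec; yes; no)
open import Relation.Nullary.Decidable using (⌊_⌋)
open import Relation.Binary.Definitions using (tri<; tri≈; tri>)
open import Relation.Binary.PropositionalEquality hiding ([_])

same-residue-gap : ∀ x y r .{{_ : NonZero r}} → x % r ≡ y % r → x < y → x + r ≤ y
same-residue-gap x y r eq x<y = begin
    x + r                     ≡⟨ cong (_+ r) (m≡m%n+[m/n]*n x r) ⟩
    x % r + x / r * r + r     ≡⟨ +-assoc (x % r) (x / r * r) r ⟩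
    x % r + (x / r * r + r)   ≡⟨ cong₂ _+_ eq (+-comm (x / r * r) r) ⟩
    y % r + suc (x / r) * r   ≤⟨ +-monoʳ-≤ (y % r) (*-monoˡ-≤ r quotient<) ⟩
    y % r + y / r * r         ≡⟨ sym (m≡m%n+[m/n]*n y r) ⟩
    y                         ∎
  where
  open ≤-Reasoning
  quotient< : x / r < y / r
  quotient< = *-cancelʳ-< r (x / r) (y / r) (+-cancelˡ-< (y % r) _ _
    (subst₂ _<_ (trans (m≡m%n+[m/n]*n x r) (cong (_+ x / r * r) eq)) (m≡m%n+[m/n]*n y r) x<y))

+-residue-gap : ∀ N .{{_ : NonZero N}} a c c′ → (a + c) % N ≡ (a + c′) % N → c < c′ → N ≤ c′
+-residue-gap N a c c′ eq c<c′ = begin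
    N          ≤⟨ m≤n+m N c ⟩
    c + N      ≤⟨ +-cancelˡ-≤ a _ _ (subst (_≤ a + c′) (+-assoc a c N)
                    (same-residue-gap _ _ N eq (+-monoʳ-< a c<c′))) ⟩
    c′         ∎
  where open ≤-Reasoning

+-mod-injective : ∀ N .{{_ : NonZero N}} (a b b′ : Fin N) →
  (toℕ a + toℕ b) % N ≡ (toℕ a + toℕ b′) % N → b ≡ b′
+-mod-injective N a b b′ eq with <-cmp (toℕ b) (toℕ b′)
... | tri< lt _ _ = ⊥-elim (<⇒≱ (FinP.toℕ<n b′) (+-residue-gap N (toℕ a) _ _ eq lt))
... | tri≈ _ e _  = FinP.toℕ-injective e
... | tri> _ _ gt = ⊥-elim (<⇒≱ (FinP.toℕ<n b) (+-residue-gap N (toℕ a) _ _ (sym eq) gt))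

+-mod-surjective : ∀ N .{{_ : NonZero N}} (a : Fin N) s → s < N → ∃[ b ] ((toℕ a + toℕ b) % N ≡ s)
+-mod-surjective N a s s<N = fromℕ< (m%n<n m N) , (begin
    (toℕ a + toℕ (fromℕ< (m%n<n m N))) % N ≡⟨ cong (λ z → (toℕ a + z) % N) (FinP.toℕ-fromℕ< (m%n<n m N)) ⟩
    (toℕ a + m % N) % N                   ≡⟨ %-distribˡ-+ (toℕ a) (m % N) N ⟩
    (toℕ a % N + m % N % N) % N           ≡⟨ cong (λ z → (toℕ a % N + z) % N) (m%n%n≡m%n m N) ⟩
    (toℕ a % N + m % N) % N               ≡⟨ sym (%-distribˡ-+ (toℕ a) m N) ⟩
    (toℕ a + m) % N                       ≡⟨ cong (_% N) (m+[n∸m]≡n a≤s+N) ⟩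
    (s + N) % N                           ≡⟨ [m+n]%n≡m%n s N ⟩
    s % N                                 ≡⟨ m<n⇒m%n≡m s<N ⟩
    s                                     ∎)
  where
  open ≡-Reasoning
  m : ℕ
  m = s + N ∸ toℕ a
  a≤s+N : toℕ a ≤ s + N
  a≤s+N = ≤-trans (<⇒≤ (FinP.toℕ<n a)) (m≤n+m N s)

block-unique : ∀ N .{{_ : NonZero N}} {p q s s′} → s < N → s′ < N →
  p * N + suc s ≡ q * N + suc s′ → p ≡ q × s ≡ s′
block-unique N {p} {q} {s} {s′} s<N s′<N eq = *-cancelʳ-≡ p q N (+-cancelˡ-≡ s _ _ eq′′) , s≡s′
  where
  eq′ : s + p * N ≡ s′ + q * N
  eq′ = begin
    s + p * N       ≡⟨ +-comm s (p * N) ⟩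
    p * N + s       ≡⟨ suc-injective (trans (sym (+-suc (p * N) s)) (trans eq (+-suc (q * N) s′))) ⟩
    q * N + s′      ≡⟨ +-comm (q * N) s′ ⟩
    s′ + q * N      ∎
    where open ≡-Reasoning
  s≡s′ : s ≡ s′
  s≡s′ = begin
    s                   ≡⟨ sym (m<n⇒m%n≡m s<N) ⟩
    s % N               ≡⟨ sym ([m+kn]%n≡m%n s p N) ⟩
    (s + p * N) % N     ≡⟨ cong (_% N) eq′ ⟩
    (s′ + q * N) % N    ≡⟨ [m+kn]%n≡m%n s′ q N ⟩
    s′ % N              ≡⟨ m<n⇒m%n≡m s′<N ⟩
    s′                  ∎
    where open ≡-Reasoning
  eq′′ : s + p * N ≡ s + q * N
  eq′′ = trans eq′ (cong (_+ q * N) (sym s≡s′))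

block-decomposition : ∀ k N .{{_ : NonZero N}} → suc k ≡ k / N * N + suc (k % N)
block-decomposition k N = begin
  suc k                      ≡⟨ cong suc (m≡m%n+[m/n]*n k N) ⟩
  suc (k % N + k / N * N)    ≡⟨ cong suc (+-comm (k % N) (k / N * N)) ⟩
  suc (k / N * N + k % N)    ≡⟨ sym (+-suc (k / N * N) (k % N)) ⟩
  k / N * N + suc (k % N)    ∎
  where open ≡-Reasoning

suc-pred-pos : ∀ {a} → 1 ≤ a → suc (pred a) ≡ a
suc-pred-pos (s≤s _) = refl

pred-injective-pos : ∀ {a b} → 1 ≤ a → 1 ≤ b → pred a ≡ pred b → a ≡ b
pred-injective-pos (s≤s _) (s≤s _) eq = cong suc eq

block-upper : ∀ {a} N s → 1 ≤ a → s < N → pred a * N + suc s ≤ a * N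
block-upper {suc a} N s _ s<N = ≤-trans (+-monoʳ-≤ (a * N) s<N) (≤-reflexive (+-comm (a * N) N))

block-index-≤ : ∀ N .{{_ : NonZero N}} p s k → p * N + suc s ≤ suc k → p ≤ k / N
block-index-≤ N p s k le = subst (_≤ k / N) (m*n/n≡m p N)
  (/-monoˡ-≤ N (m+n≤o⇒m≤o (p * N) (s≤s⁻¹ (subst (_≤ suc k) (+-suc (p * N) s) le))))

window-decomposition : ∀ m r k → m < k → k ≤ m + r → ∃[ j ] (j < r × k ≡ m + suc j)
window-decomposition m r k m<k k≤m+r = k ∸ suc m , +-cancelˡ-≤ m _ _ (subst (_≤ m + r) k≡ k≤m+r) , k≡
  where
  k≡ : k ≡ m + suc (k ∸ suc m)
  k≡ = trans (sym (m+[n∸m]≡n m<k)) (sym (+-suc m (k ∸ suc m)))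

count≡length-filter : ∀ {A : Set} (f : A → Bool) (xs : List A) →
  sum (map (λ x → if f x then 1 else 0) xs) ≡ length (filter (λ x → f x Bool.≟ true) xs)
count≡length-filter f [] = refl
count≡length-filter f (x ∷ xs) with f x
... | true  = cong suc (count≡length-filter f xs)
... | false = count≡length-filter f xs

lookup-injective : ∀ {A : Set} {xs : List A} → Unique xs → ∀ i j → lookup xs i ≡ lookup xs j → i ≡ j
lookup-injective (_ ∷ _)  Fin.zero    Fin.zero    _  = refl
lookup-injective (x∉ ∷ _) Fin.zero    (Fin.suc j) eq = ⊥-elim (All.lookup x∉ (∈-lookup j) eq)
lookup-injective (x∉ ∷ _) (Fin.suc i) Fin.zero    eq = ⊥-elim (All.lookup x∉ (∈-lookup i) (sym eq))
lookup-injective (_ ∷ u)  (Fin.suc i) (Fin.suc j) eq = cong Fin.suc (lookup-injective u i j eq)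

-- An injective endofunction of Fin m is surjective: a missed value would give
-- an injection of Fin m into Fin (m - 1).
injective⇒surjective : ∀ m (f : Fin m → Fin m) → Injective _≡_ _≡_ f → ∀ j → ∃[ i ] f i ≡ j
injective⇒surjective (suc m) f inj j with FinP.any? (λ i → f i FinP.≟ j)
... | yes hit = hit
... | no miss = ⊥-elim (1+n≰n (FinP.injective⇒≤ {f = squeeze} squeeze-injective))
  where
  squeeze : Fin (suc m) → Fin m
  squeeze i = punchOut {i = j} {j = f i} (λ e → miss (i , sym e))
  squeeze-injective : Injective _≡_ _≡_ squeeze
  squeeze-injective {i} {k} e =
    inj (FinP.punchOut-injective (λ e′ → miss (i , sym e′)) (λ e′ → miss (k , sym e′)) e)

neighbours : (G : Graph) → Fin (n G) → List (Fin (n G))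
neighbours G v = filter (λ w → adj G v w Bool.≟ true) (allFin (n G))

degree≡length-neighbours : (G : Graph) (v : Fin (n G)) → degree G v ≡ length (neighbours G v)
degree≡length-neighbours G v = count≡length-filter (adj G v) (allFin (n G))

∈-neighbours⁺ : (G : Graph) {v w : Fin (n G)} → adj G v w ≡ true → w ∈ neighbours G v
∈-neighbours⁺ G {v} {w} = ∈-filter⁺ (λ w → adj G v w Bool.≟ true) {xs = allFin (n G)} (∈-allFin w)

∈-neighbours⁻ : (G : Graph) {v w : Fin (n G)} → w ∈ neighbours G v → adj G v w ≡ true
∈-neighbours⁻ G {v} w∈ = proj₂ (∈-filter⁻ (λ w → adj G v w Bool.≟ true) {xs = allFin (n G)} w∈)

neighbours-unique : (G : Graph) (v : Fin (n G)) → Unique (neighbours G v)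
neighbours-unique G v = filter⁺ (λ w → adj G v w Bool.≟ true) {xs = allFin (n G)} (allFin⁺ (n G))

degree-positive : (G : Graph) {v w : Fin (n G)} → adj G v w ≡ true → 0 < degree G v
degree-positive G {v} vw = subst (0 <_) (sym (degree≡length-neighbours G v)) (∈-length (∈-neighbours⁺ G vw))

maxWhere : ∀ {A : Set} → (A → Bool) → (A → ℕ) → List A → ℕ
maxWhere p f []       = 0
maxWhere p f (x ∷ xs) = if p x then f x ⊔ maxWhere p f xs else maxWhere p f xs

maxWhere-upper : ∀ {A : Set} (p : A → Bool) (f : A → ℕ) {x} xs →
  x ∈ xs → p x ≡ true → f x ≤ maxWhere p f xs
maxWhere-upper p f (y ∷ xs) (here refl) px rewrite px = m≤m⊔n (f y) (maxWhere p f xs)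
maxWhere-upper p f (y ∷ xs) (there x∈) px with p y
... | true  = ≤-trans (maxWhere-upper p f xs x∈ px) (m≤n⊔m (f y) (maxWhere p f xs))
... | false = maxWhere-upper p f xs x∈ px

maxWhere-least : ∀ {A : Set} (p : A → Bool) (f : A → ℕ) {b} xs →
  (∀ x → p x ≡ true → f x ≤ b) → maxWhere p f xs ≤ b
maxWhere-least p f []       bound = z≤n
maxWhere-least p f (y ∷ xs) bound with p y in py
... | true  = ⊔-lub (bound y py) (maxWhere-least p f xs bound)
... | false = maxWhere-least p f xs bound

maxWhere-attained : ∀ {A : Set} (p : A → Bool) (f : A → ℕ) xs →
  maxWhere p f xs ≡ 0 ⊎ ∃[ x ] (p x ≡ true × f x ≡ maxWhere p f xs)
maxWhere-attained p f []       = inj₁ refl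
maxWhere-attained p f (y ∷ xs) with p y in py
... | false = maxWhere-attained p f xs
... | true with ⊔-sel (f y) (maxWhere p f xs) | maxWhere-attained p f xs
...   | inj₁ y-max | _                 = inj₂ (y , py , sym y-max)
...   | inj₂ xs-max | inj₁ none        = inj₁ (trans xs-max none)
...   | inj₂ xs-max | inj₂ (x , px , e) = inj₂ (x , px , trans e (sym xs-max))

module IntervalColouringFacts {G : Graph} {t : ℕ} {c : Colouring G}
                              (isc : IsIntervalColouring G t c) where
  open IsIntervalColouring isc

  -- If colours x and y ≥ x + d both occur at v, then so do x, x + 1, …, x + d,
  -- on d + 1 distinct edges; hence v has more than d neighbours.
  wide-span⇒degree : ∀ v x y d → ColourAt G c v x → ColourAt G c v y → x + d ≤ y → d < degree G v
  wide-span⇒degree v x y d cx cy x+d≤y =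
    subst (d <_) (sym (degree≡length-neighbours G v)) (FinP.injective⇒≤ {f = slot} slot-injective)
    where
    coloured : (i : Fin (suc d)) → ColourAt G c v (x + toℕ i)
    coloured i = interval v x y (x + toℕ i) cx cy (m≤m+n x (toℕ i))
                   (≤-trans (+-monoʳ-≤ x (FinP.toℕ≤pred[n] i)) x+d≤y)
    endpoint : Fin (suc d) → Fin (n G)
    endpoint i = proj₁ (coloured i)
    slot : Fin (suc d) → Fin (length (neighbours G v))
    slot i = Any.index (∈-neighbours⁺ G (proj₁ (proj₂ (coloured i))))
    slot-injective : Injective _≡_ _≡_ slot
    slot-injective {i} {j} e = FinP.toℕ-injective (+-cancelˡ-≡ x _ _ (begin
      x + toℕ i            ≡⟨ sym (proj₂ (proj₂ (coloured i))) ⟩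
      c v (endpoint i)     ≡⟨ cong (c v) same-endpoint ⟩
      c v (endpoint j)     ≡⟨ proj₂ (proj₂ (coloured j)) ⟩
      x + toℕ j            ∎))
      where
      open ≡-Reasoning
      same-endpoint : endpoint i ≡ endpoint j
      same-endpoint = trans (lookup-index (∈-neighbours⁺ G (proj₁ (proj₂ (coloured i)))))
                        (trans (cong (lookup (neighbours G v)) e)
                          (sym (lookup-index (∈-neighbours⁺ G (proj₁ (proj₂ (coloured j)))))))

  top : Fin (n G) → ℕ
  top u = maxWhere (adj G u) (c u) (allFin (n G))

  top-upper : ∀ u w → adj G u w ≡ true → c u w ≤ top u
  top-upper u w uw = maxWhere-upper (adj G u) (c u) (allFin (n G)) (∈-allFin w) uw

  top≤t : ∀ u → top u ≤ t
  top≤t u = maxWhere-least (adj G u) (c u) (allFin (n G)) (λ w uw → proj₂ (inRange u w uw))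

  top-reaches-t : ∃[ u ] top u ≡ t
  top-reaches-t with allUsed t positive ≤-refl
  ... | u , w , uw , cuw = u , ≤-antisym (top≤t u) (subst (_≤ top u) cuw (top-upper u w uw))

  top-attained : ∀ u → 1 ≤ top u → ColourAt G c u (top u)
  top-attained u pos with maxWhere-attained (adj G u) (c u) (allFin (n G))
  ... | inj₁ none = ⊥-elim (<⇒≢ pos (sym none))
  ... | inj₂ edge = edge

-- Reducing an interval colouring of an r-regular graph H modulo r gives a
-- proper colouring with r colours in which every vertex sees all r colours:
-- r + 1 colours at one vertex are impossible, so equal residues mean equal colours.
module ResidueColouring {H : Graph} {r : ℕ} .{{_ : NonZero r}} {s : ℕ} {β : Colouring H}
                        (isβ : IsIntervalColouring H s β) (reg : Regular H r) where
  open IsIntervalColouring isβ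
  open IntervalColouringFacts isβ

  residue : Fin (n H) → Fin (n H) → ℕ
  residue v w = β v w % r

  residue<r : ∀ v w → residue v w < r
  residue<r v w = m%n<n (β v w) r

  residue-symmetric : ∀ v w → adj H v w ≡ true → residue v w ≡ residue w v
  residue-symmetric v w vw = cong (_% r) (symmetric v w vw)

  -- Two colours at v with equal residues cannot differ: they would span r + 1 colours.
  residue-no-gap : ∀ v u w → adj H v u ≡ true → adj H v w ≡ true →
                   residue v u ≡ residue v w → β v u < β v w → ⊥
  residue-no-gap v u w vu vw eq lt = <-irrefl (sym (reg v))
    (wide-span⇒degree v _ _ r (u , vu , refl) (w , vw , refl) (same-residue-gap _ _ r eq lt))

  residue-proper : ∀ v u w → adj H v u ≡ true → adj H v w ≡ true → residue v u ≡ residue v w → u ≡ w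
  residue-proper v u w vu vw eq with <-cmp (β v u) (β v w)
  ... | tri< lt _ _ = ⊥-elim (residue-no-gap v u w vu vw eq lt)
  ... | tri≈ _ e _  = proper v u w vu vw e
  ... | tri> _ _ gt = ⊥-elim (residue-no-gap v w u vw vu (sym eq) gt)

  -- The r neighbours of v have r distinct residues, so every residue occurs.
  residue-complete : ∀ v j → j < r → ∃[ w ] (adj H v w ≡ true × residue v w ≡ j)
  residue-complete v j j<r =
    lookup ns i , ∈-neighbours⁻ H (∈-lookup i) , (begin
      residue v (lookup ns i)      ≡⟨ sym (FinP.toℕ-fromℕ< (bounded i)) ⟩
      toℕ (label i)                ≡⟨ cong toℕ labelled ⟩
      toℕ (fromℕ< j<m)             ≡⟨ FinP.toℕ-fromℕ< j<m ⟩
      j                            ∎)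
    where
    open ≡-Reasoning
    ns : List (Fin (n H))
    ns = neighbours H v
    m : ℕ
    m = length ns
    m≡r : m ≡ r
    m≡r = trans (sym (degree≡length-neighbours H v)) (reg v)
    bounded : ∀ i → residue v (lookup ns i) < m
    bounded i = subst (residue v (lookup ns i) <_) (sym m≡r) (residue<r v (lookup ns i))
    label : Fin m → Fin m
    label i = fromℕ< (bounded i)
    label-injective : Injective _≡_ _≡_ label
    label-injective {i} {k} e = lookup-injective (neighbours-unique H v) i k
      (residue-proper v _ _ (∈-neighbours⁻ H (∈-lookup i)) (∈-neighbours⁻ H (∈-lookup k))
        (trans (sym (FinP.toℕ-fromℕ< (bounded i))) (trans (cong toℕ e) (FinP.toℕ-fromℕ< (bounded k)))))
    j<m : j < m
    j<m = subst (j <_) (sym m≡r) j<r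
    preimage : ∃[ i ] label i ≡ fromℕ< j<m
    preimage = injective⇒surjective m label label-injective (fromℕ< j<m)
    i : Fin m
    i = proj₁ preimage
    labelled : label i ≡ fromℕ< j<m
    labelled = proj₂ preimage

∨-∧-cases : ∀ {P : Set} a (d : Dec P) h → a ∨ (⌊ d ⌋ ∧ h) ≡ true →
            a ≡ true ⊎ (a ≡ false × P × h ≡ true)
∨-∧-cases true  d        h     _  = inj₁ refl
∨-∧-cases false (yes p)  true  _  = inj₂ (refl , p , refl)
∨-∧-cases false (yes p)  false ()
∨-∧-cases false (no _)   h     ()

module Coordinates (G H : Graph) where

  U : Fin (n G * n H) → Fin (n G)
  U x = proj₁ (remQuot {n G} (n H) x)

  V : Fin (n G * n H) → Fin (n H)
  V x = proj₂ (remQuot {n G} (n H) x)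

  U-combine : ∀ (u : Fin (n G)) (v : Fin (n H)) → U (combine u v) ≡ u
  U-combine u v = cong proj₁ (FinP.remQuot-combine u v)

  V-combine : ∀ (u : Fin (n G)) (v : Fin (n H)) → V (combine u v) ≡ v
  V-combine u v = cong proj₂ (FinP.remQuot-combine u v)

  coordinates-injective : ∀ x y → U x ≡ U y → V x ≡ V y → x ≡ y
  coordinates-injective x y eqU eqV = begin
    x                     ≡⟨ sym (FinP.combine-remQuot {n G} (n H) x) ⟩
    combine (U x) (V x)   ≡⟨ cong₂ combine eqU eqV ⟩
    combine (U y) (V y)   ≡⟨ FinP.combine-remQuot {n G} (n H) y ⟩
    y                     ∎
    where open ≡-Reasoning

  data EdgeKind (x y : Fin (n G * n H)) : Set where
    across : adj G (U x) (U y) ≡ true → EdgeKind x y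
    within : adj G (U x) (U y) ≡ false → U x ≡ U y → adj H (V x) (V y) ≡ true → EdgeKind x y

  edgeKind : ∀ x y → adj (G [ H ]) x y ≡ true → EdgeKind x y
  edgeKind x y xy with ∨-∧-cases (adj G (U x) (U y)) (U x Fin.≟ U y) (adj H (V x) (V y)) xy
  ... | inj₁ uu′           = across uu′
  ... | inj₂ (¬uu′ , u≡ , vv′) = within ¬uu′ u≡ vv′

  across-edge : ∀ x y → adj G (U x) (U y) ≡ true → adj (G [ H ]) x y ≡ true
  across-edge x y uu′ rewrite uu′ = refl

  within-edge : ∀ x y → U x ≡ U y → adj H (V x) (V y) ≡ true → adj (G [ H ]) x y ≡ true
  within-edge x y u≡ vv′ with U x Fin.≟ U y
  ... | yes _ rewrite vv′ = ∨-zeroʳ (adj G (U x) (U y))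
  ... | no u≢ = ⊥-elim (u≢ u≡)

-- An edge (u,v)(u′,v′) with uu′ ∈ E(G) gets colour (α(uu′) - 1)·N + 1 + ((v + v′) mod N):
-- the N edges from (u,v) to the copy of u′ use the whole α(uu′)-th block of N colours.
-- An edge (u,v)(u,v′) with vv′ ∈ E(H) gets colour top(u)·N + 1 + (β(vv′) mod r),
-- filling the r colours just above the blocks used at (u,v).
module Composition (G H : Graph) (r : ℕ) .{{_ : NonZero r}} .{{_ : NonZero (n H)}}
                   {t : ℕ} {α : Colouring G} (isα : IsIntervalColouring G t α)
                   {s : ℕ} {β : Colouring H} (isβ : IsIntervalColouring H s β)
                   (reg : Regular H r) where
  open Coordinates G H
  open IntervalColouringFacts isα
  open ResidueColouring isβ reg
  module α = IsIntervalColouring isα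

  N : ℕ
  N = n H

  outerColour : ℕ → Fin N → Fin N → ℕ
  outerColour a v v′ = pred a * N + suc ((toℕ v + toℕ v′) % N)

  innerColour : Fin (n G) → Fin N → Fin N → ℕ
  innerColour u v v′ = top u * N + suc (residue v v′)

  colour : Colouring (G [ H ])
  colour x y = if adj G (U x) (U y) then outerColour (α (U x) (U y)) (V x) (V y)
                                    else innerColour (U x) (V x) (V y)

  colour-across : ∀ x y → adj G (U x) (U y) ≡ true → colour x y ≡ outerColour (α (U x) (U y)) (V x) (V y)
  colour-across x y uu′ rewrite uu′ = refl

  colour-within : ∀ x y → adj G (U x) (U y) ≡ false → colour x y ≡ innerColour (U x) (V x) (V y)
  colour-within x y ¬uu′ rewrite ¬uu′ = refl

  colour-positive : ∀ x y → 1 ≤ colour x y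
  colour-positive x y with adj G (U x) (U y)
  ... | true  = ≤-trans 0<1+n (m≤n+m _ (pred (α (U x) (U y)) * N))
  ... | false = ≤-trans 0<1+n (m≤n+m _ (top (U x) * N))

  across≤top : ∀ x y → adj G (U x) (U y) ≡ true → colour x y ≤ top (U x) * N
  across≤top x y uu′ = begin
    colour x y                              ≡⟨ colour-across x y uu′ ⟩
    outerColour (α (U x) (U y)) (V x) (V y) ≤⟨ block-upper N _ (proj₁ (α.inRange _ _ uu′)) (m%n<n _ N) ⟩
    α (U x) (U y) * N                       ≤⟨ *-monoˡ-≤ N (top-upper (U x) (U y) uu′) ⟩
    top (U x) * N                           ∎
    where open ≤-Reasoning

  top<within : ∀ x y → adj G (U x) (U y) ≡ false → top (U x) * N < colour x y
  top<within x y ¬uu′ = subst (top (U x) * N <_) (sym (colour-within x y ¬uu′)) (m<m+n (top (U x) * N) 0<1+n)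

  colour≤top+r : ∀ x y → adj (G [ H ]) x y ≡ true → colour x y ≤ top (U x) * N + r
  colour≤top+r x y xy with edgeKind x y xy
  ... | across uu′       = ≤-trans (across≤top x y uu′) (m≤m+n (top (U x) * N) r)
  ... | within ¬uu′ _ _ = subst (_≤ top (U x) * N + r) (sym (colour-within x y ¬uu′))
                            (+-monoʳ-≤ (top (U x) * N) (residue<r (V x) (V y)))

  outer-occurs : ∀ x u′ v′ → adj G (U x) u′ ≡ true →
                 ColourAt (G [ H ]) colour x (outerColour (α (U x) u′) (V x) v′)
  outer-occurs x u′ v′ uu′ = combine u′ v′ , across-edge x y uu″ , (begin
      colour x y                              ≡⟨ colour-across x y uu″ ⟩
      outerColour (α (U x) (U y)) (V x) (V y) ≡⟨ cong₂ (λ p q → outerColour (α (U x) p) (V x) q)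
                                                   (U-combine u′ v′) (V-combine u′ v′) ⟩
      outerColour (α (U x) u′) (V x) v′       ∎)
    where
    open ≡-Reasoning
    y : Fin (n G * N)
    y = combine u′ v′
    uu″ : adj G (U x) (U y) ≡ true
    uu″ = subst (λ z → adj G (U x) z ≡ true) (sym (U-combine u′ v′)) uu′

  inner-occurs : ∀ x v′ → adj H (V x) v′ ≡ true → ColourAt (G [ H ]) colour x (innerColour (U x) (V x) v′)
  inner-occurs x v′ vv′ = y , within-edge x y (sym (U-combine (U x) v′)) vv″ , (begin
      colour x y                       ≡⟨ colour-within x y ¬uu ⟩
      innerColour (U x) (V x) (V y)    ≡⟨ cong (innerColour (U x) (V x)) (V-combine (U x) v′) ⟩
      innerColour (U x) (V x) v′       ∎)
    where
    open ≡-Reasoning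
    y : Fin (n G * N)
    y = combine (U x) v′
    vv″ : adj H (V x) (V y) ≡ true
    vv″ = subst (λ z → adj H (V x) z ≡ true) (sym (V-combine (U x) v′)) vv′
    ¬uu : adj G (U x) (U y) ≡ false
    ¬uu = subst (λ z → adj G (U x) z ≡ false) (sym (U-combine (U x) v′)) (irrefl G (U x))

  -- If the G-colour 1 + k / N occurs at U x, then colour k + 1 occurs at x:
  -- it lies in that block and is reached by choosing the H-coordinate.
  outer-fill : ∀ x k → ColourAt G α (U x) (suc (k / N)) → ColourAt (G [ H ]) colour x (suc k)
  outer-fill x k (u′ , uu′ , αu′) = subst (ColourAt (G [ H ]) colour x) reaches-k (outer-occurs x u′ b uu′)
    where
    shift : ∃[ b ] ((toℕ (V x) + toℕ b) % N ≡ k % N)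
    shift = +-mod-surjective N (V x) (k % N) (m%n<n k N)
    b : Fin N
    b = proj₁ shift
    reaches-k : outerColour (α (U x) u′) (V x) b ≡ suc k
    reaches-k = trans (cong₂ (λ a ρ → pred a * N + suc ρ) αu′ (proj₂ shift)) (sym (block-decomposition k N))

  inner-fill : ∀ x j → j < r → ColourAt (G [ H ]) colour x (top (U x) * N + suc j)
  inner-fill x j j<r = subst (ColourAt (G [ H ]) colour x) (cong (λ ρ → top (U x) * N + suc ρ) (proj₂ (proj₂ w)))
                         (inner-occurs x (proj₁ w) (proj₁ (proj₂ w)))
    where
    w : ∃[ w ] (adj H (V x) w ≡ true × residue (V x) w ≡ j)
    w = residue-complete (V x) j j<r

  -- Every colour between an across colour at x and top(U x)·N occurs at x:
  -- its block index lies between two colours of α at U x.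
  outer-interval : ∀ x y k → adj G (U x) (U y) ≡ true → colour x y ≤ k → k ≤ top (U x) * N →
                   ColourAt (G [ H ]) colour x k
  outer-interval x y zero    uu′ c≤k _ = ⊥-elim (<⇒≱ (colour-positive x y) c≤k)
  outer-interval x y (suc k) uu′ c≤k k≤top = outer-fill x k between
    where
    a : ℕ
    a = α (U x) (U y)
    a≥1 : 1 ≤ a
    a≥1 = proj₁ (α.inRange _ _ uu′)
    a≤block : a ≤ suc (k / N)
    a≤block = subst (_≤ suc (k / N)) (suc-pred-pos a≥1)
      (s≤s (block-index-≤ N (pred a) _ k (subst (_≤ suc k) (colour-across x y uu′) c≤k)))
    block≤top : suc (k / N) ≤ top (U x)
    block≤top = m<n*o⇒m/o<n k≤top
    between : ColourAt G α (U x) (suc (k / N))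
    between = α.interval (U x) a (top (U x)) (suc (k / N)) (U y , uu′ , refl)
                (top-attained (U x) (≤-trans a≥1 (top-upper (U x) (U y) uu′))) a≤block block≤top

  colour-symmetric : ∀ x y → adj (G [ H ]) x y ≡ true → colour x y ≡ colour y x
  colour-symmetric x y xy with edgeKind x y xy
  ... | across uu′ = begin
      colour x y                              ≡⟨ colour-across x y uu′ ⟩
      outerColour (α (U x) (U y)) (V x) (V y) ≡⟨ cong₂ (λ a m → pred a * N + suc (m % N))
                                                   (α.symmetric _ _ uu′) (+-comm (toℕ (V x)) (toℕ (V y))) ⟩
      outerColour (α (U y) (U x)) (V y) (V x) ≡⟨ sym (colour-across y x (trans (symm G (U y) (U x)) uu′)) ⟩
      colour y x                              ∎
    where open ≡-Reasoning
  ... | within ¬uu′ u≡ vv′ = begin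
      colour x y                              ≡⟨ colour-within x y ¬uu′ ⟩
      innerColour (U x) (V x) (V y)           ≡⟨ cong₂ (λ u ρ → top u * N + suc ρ) u≡ (residue-symmetric _ _ vv′) ⟩
      innerColour (U y) (V y) (V x)           ≡⟨ sym (colour-within y x (trans (symm G (U y) (U x)) ¬uu′)) ⟩
      colour y x                              ∎
    where open ≡-Reasoning

  colour-proper : ∀ x y z → adj (G [ H ]) x y ≡ true → adj (G [ H ]) x z ≡ true →
                  colour x y ≡ colour x z → y ≡ z
  colour-proper x y z xy xz eq with edgeKind x y xy | edgeKind x z xz
  ... | across uy | across uz = coordinates-injective y z sameU sameV
    where
    blocks : pred (α (U x) (U y)) ≡ pred (α (U x) (U z)) ×
             (toℕ (V x) + toℕ (V y)) % N ≡ (toℕ (V x) + toℕ (V z)) % N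
    blocks = block-unique N (m%n<n _ N) (m%n<n _ N)
               (trans (sym (colour-across x y uy)) (trans eq (colour-across x z uz)))
    sameU : U y ≡ U z
    sameU = α.proper (U x) (U y) (U z) uy uz
              (pred-injective-pos (proj₁ (α.inRange _ _ uy)) (proj₁ (α.inRange _ _ uz)) (proj₁ blocks))
    sameV : V y ≡ V z
    sameV = +-mod-injective N (V x) (V y) (V z) (proj₂ blocks)
  ... | across uy | within ¬uz _ _ =
    ⊥-elim (<⇒≱ (top<within x z ¬uz) (subst (_≤ top (U x) * N) eq (across≤top x y uy)))
  ... | within ¬uy _ _ | across uz =
    ⊥-elim (<⇒≱ (top<within x y ¬uy) (subst (_≤ top (U x) * N) (sym eq) (across≤top x z uz)))
  ... | within ¬uy u≡y vy | within ¬uz u≡z vz = coordinates-injective y z (trans (sym u≡y) u≡z)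
    (residue-proper (V x) (V y) (V z) vy vz (suc-injective (+-cancelˡ-≡ (top (U x) * N) _ _
      (trans (sym (colour-within x y ¬uy)) (trans eq (colour-within x z ¬uz))))))

  v₀ : Fin N
  v₀ = fromℕ< (>-nonZero⁻¹ N)

  -- Colours up to t·N fill the blocks of the colours of α; colours above t·N
  -- are inner colours at a vertex over one whose top colour is t.
  colour-used : ∀ k → 1 ≤ k → k ≤ t * N + r → ∃[ x ] ColourAt (G [ H ]) colour x k
  colour-used (suc k) _ k≤T with suc k ≤? t * N
  ... | yes k≤tN = x , outer-fill x k (subst (λ u → ColourAt G α u (suc (k / N))) (sym (U-combine u v₀)) (proj₂ block-used))
    where
    block-used : ∃[ u ] ColourAt G α u (suc (k / N))
    block-used = α.allUsed (suc (k / N)) (s≤s z≤n) (m<n*o⇒m/o<n k≤tN)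
    u : Fin (n G)
    u = proj₁ block-used
    x : Fin (n G * N)
    x = combine u v₀
  ... | no k≰tN = x , subst (ColourAt (G [ H ]) colour x) (sym k≡) (inner-fill x j j<r)
    where
    u : Fin (n G)
    u = proj₁ top-reaches-t
    x : Fin (n G * N)
    x = combine u v₀
    top≡t : top (U x) ≡ t
    top≡t = trans (cong top (U-combine u v₀)) (proj₂ top-reaches-t)
    window : ∃[ j ] (j < r × suc k ≡ top (U x) * N + suc j)
    window = window-decomposition (top (U x) * N) r (suc k)
               (subst (λ m → m * N < suc k) (sym top≡t) (≰⇒> k≰tN))
               (subst (λ m → suc k ≤ m * N + r) (sym top≡t) k≤T)
    j : ℕ
    j = proj₁ window
    j<r : j < r
    j<r = proj₁ (proj₂ window)
    k≡ : suc k ≡ top (U x) * N + suc j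
    k≡ = proj₂ (proj₂ window)

  -- Up to top(U x)·N the colours at x are across colours filling blocks;
  -- above it they are the inner colours, which fill the next r colours.
  colour-interval : ∀ x a b k → ColourAt (G [ H ]) colour x a → ColourAt (G [ H ]) colour x b →
                    a ≤ k → k ≤ b → ColourAt (G [ H ]) colour x k
  colour-interval x a b k (y , xy , ya) (z , xz , zb) a≤k k≤b with k ≤? top (U x) * N
  ... | yes k≤top with edgeKind x y xy
  ...   | across uy = outer-interval x y k uy (subst (_≤ k) (sym ya) a≤k) k≤top
  ...   | within ¬uy _ _ = ⊥-elim (<⇒≱ (top<within x y ¬uy) (≤-trans (subst (_≤ k) (sym ya) a≤k) k≤top))
  colour-interval x a b k (y , xy , ya) (z , xz , zb) a≤k k≤b | no k≰top =
    subst (ColourAt (G [ H ]) colour x) (sym (proj₂ (proj₂ window))) (inner-fill x _ (proj₁ (proj₂ window)))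
    where
    window : ∃[ j ] (j < r × k ≡ top (U x) * N + suc j)
    window = window-decomposition (top (U x) * N) r k (≰⇒> k≰top)
               (≤-trans k≤b (subst (_≤ top (U x) * N + r) zb (colour≤top+r x z xz)))

  interval-colouring : HasIntervalColouring (G [ H ]) (t * N + r)
  interval-colouring = colour , record
    { positive  = ≤-trans (>-nonZero⁻¹ r) (m≤n+m r (t * N))
    ; symmetric = colour-symmetric
    ; inRange   = λ x y xy → colour-positive x y ,
                    ≤-trans (colour≤top+r x y xy) (+-monoˡ-≤ r (*-monoˡ-≤ N (top≤t (U x))))
    ; proper    = colour-proper
    ; allUsed   = colour-used
    ; interval  = colour-interval
    }

-- Interval colourings of G (with t colours) and of an r-regular graph H give an
-- interval (t·|V(H)| + r)-colouring of G [ H ]; H has an edge, so |V(H)| and r are positive.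
composition-colouring : (G H : Graph) (r : ℕ) → IntervalColourable H → Regular H r →
  ∀ t → HasIntervalColouring G t → HasIntervalColouring (G [ H ]) (t * n H + r)
composition-colouring G H r (_ , β , isβ) reg t (α , isα) =
  Composition.interval-colouring G H r {{r≢0}} {{N≢0}} isα isβ reg
  where
  edge : ∃[ v ] ColourAt H β v 1
  edge = IsIntervalColouring.allUsed isβ 1 ≤-refl (IsIntervalColouring.positive isβ)
  N≢0 : NonZero (n H)
  N≢0 = FinP.nonZeroIndex (proj₁ edge)
  r≢0 : NonZero r
  r≢0 = >-nonZero (subst (0 <_) (reg (proj₁ edge)) (degree-positive H (proj₁ (proj₂ (proj₂ edge)))))

corollary1 : (G H : Graph) (r : ℕ) →
    IntervalColourable G → IntervalColourable H → Regular H r →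
    IntervalColourable (G [ H ])
    × (∀ wG wGH → IsW-min G wG → IsW-min (G [ H ]) wGH → wGH ≤ wG * n H + r)
    × (∀ WG WGH → IsW-max G WG → IsW-max (G [ H ]) WGH → WG * n H + r ≤ WGH)
corollary1 G H r (t , αG) colourableH reg =
  (t * n H + r , lift t αG) ,
  (λ wG wGH (αmin , _) (_ , least) → least (wG * n H + r) (lift wG αmin)) ,
  (λ WG WGH (αmax , _) (_ , greatest) → greatest (WG * n H + r) (lift WG αmax))
  where
  lift : ∀ t → HasIntervalColouring G t → HasIntervalColouring (G [ H ]) (t * n H + r)
  lift = composition-colouring G H r colourableH reg
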